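{- For $\mathbb{P}_n,$ $n\neq 4,7$ $$d_{td}(a_i)=\begin{cases} \frac{n}{2}+1 &\text{ if } n \equiv 2 ( mod 4)\\ \frac{n+1}{2} & \text{ if } n\equiv 1(mod 4) \text{ and } i\not\equiv 1(mod 4)\\ \frac{n+1}{2}+1 & \text{ if } n\equiv 1(mod 4) \text{ and } i\equiv 1(mod 4)\\ \frac{n+1}{2} & \text{ if } n\equiv 3(mod 4) \text{ and } i\not\equiv 0(mod 4)\\ \frac{n+1}{2}+1 & \text{ if } n\equiv 3(mod 4) \text{ and } i\equiv 0(mod 4)\\ \frac{n}{2} & \text{ if } n\equiv 0(mod 4) \text{ and } i\equiv 2,3(mod 4)\\ \frac{n}{2}+1 & \text{ if } n\equiv 0(mod 4) \text{ and } i\equiv 0,1(mod 4) \end{cases}$$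
   Context: For a graph without isolated vertices, a total dominating set (TDS) is a set $S$ of vertices such that every vertex of the graph is adjacent to some vertex of $S$; a minimal TDS (MTDS) is a TDS no proper subset of which is a TDS. A vertex is compliant if some MTDS contains it, and a graph is compliant if all its vertices are compliant (the paths $\mathbb{P}_n$, $n\neq 4,7$, are compliant). For a vertex $a$ of a compliant graph, the total domination degree is $d_{td}(a)=\min\{|S| : S \text{ is an MTDS containing } a\}$. The path $\mathbb{P}_n$ has vertices $a_1,a_2,\dots,a_n$ in order. -}

module Defs where

open import Data.Nat using (ℕ; suc; _+_; _≤_; _/_; _%_)
open import Data.Fin using (Fin; toℕ)
open import Data.Fin.Subset using (Subset; _∈_; _⊂_; ∣_∣)
open import Data.Product using (Σ; _×_; ∃)
open import Data.Sum using (_⊎_)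
open import Relation.Binary.PropositionalEquality using (_≡_)
open import Relation.Nullary using (¬_)

Graph : ℕ → Set₁
Graph n = Fin n → Fin n → Set

-- The path P_n on vertices a_1,...,a_n; vertex a_i is the element of
-- Fin n with toℕ = i - 1. Consecutive vertices are adjacent.
PathAdj : (n : ℕ) → Graph n
PathAdj n u v = (suc (toℕ u) ≡ toℕ v) ⊎ (suc (toℕ v) ≡ toℕ u)

IsTDS : {n : ℕ} → Graph n → Subset n → Set
IsTDS {n} G S = (v : Fin n) → ∃ λ u → u ∈ S × G v u

IsMTDS : {n : ℕ} → Graph n → Subset n → Set
IsMTDS {n} G S = IsTDS G S × ((T : Subset n) → T ⊂ S → ¬ IsTDS G T)

TDDegreeIs : {n : ℕ} → Graph n → Fin n → ℕ → Set
TDDegreeIs {n} G a k =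
  (∃ λ S → IsMTDS G S × a ∈ S × ∣ S ∣ ≡ k)
  × ((S : Subset n) → IsMTDS G S → a ∈ S → k ≤ ∣ S ∣)

-- The case formula of the theorem, for P_n and vertex a_i (i is 1-based).
pathDtd : ℕ → ℕ → ℕ
pathDtd n i with n % 4 | i % 4
... | 2 | _ = n / 2 + 1
... | 1 | 1 = (n + 1) / 2 + 1
... | 1 | _ = (n + 1) / 2
... | 3 | 0 = (n + 1) / 2 + 1
... | 3 | _ = (n + 1) / 2
... | 0 | 2 = n / 2
... | 0 | 3 = n / 2
... | 0 | _ = n / 2 + 1
... | _ | _ = 0  -- unreachable: n % 4 < 4

-- A total dominating set S of the path is minimal as soon as every member u has a private
-- neighbour, a vertex whose only neighbour in S is u: without u that vertex is undominated.
-- Domination and private neighbours only involve five consecutive vertices, so for the upper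
-- bounds a candidate set, written as a word over ● (member) and ○, is certified by scanning its
-- windows. The optimal sets through a prescribed vertex are repetitions of the blocks ○●●○,
-- ●●○○, ○○●● or ●○○● with short ends adapted to that vertex; reading a block brings the scan
-- back to the state it started in, which certifies any number of repetitions at once.
-- For the lower bounds, an interior vertex v + 1 has a neighbour v or v + 2 in S, and the
-- dominators of v + 1 and v + 2 have different parity, so any four consecutive vertices contain
-- two members. Cutting the path into such blocks, end segments (an end vertex forces its
-- neighbour into S) and a segment around the prescribed member gives the matching counts.

module Submission where

open import Defs
open import Data.Bool using (Bool; true; false; T; not; _∧_; _∨_)
open import Data.Bool.Properties using (T-∧; T-∨; T-≡; T-not-≡; not-¬)
open import Data.Empty using (⊥-elim)
open import Data.Fin using (Fin; toℕ; fromℕ<) renaming (zero to fzero; suc to fsuc)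
open import Data.Fin.Patterns using (0F; 1F; 2F; 3F)
open import Data.Fin.Properties using (toℕ<n; toℕ-fromℕ<; toℕ-injective)
open import Data.Fin.Subset using (Subset; _∈_; _⊂_; ∣_∣)
open import Data.List using (List; []; _∷_; _++_; length; map)
open import Data.List.Properties using (length-++)
open import Data.Maybe using (Maybe; just; nothing; is-just; fromMaybe)
open import Data.Nat using (ℕ; zero; suc; _+_; _*_; _≤_; _<_; z≤n; s≤s; _/_; _%_)
open import Data.Nat.Properties
open import Data.Nat.DivMod using (m*n/n≡m; m*n%n≡0; [m+kn]%n≡m%n; result; _divMod_)
open import Data.Nat.Tactic.RingSolver using (solve-∀)
open import Data.Product using (_×_; _,_; ∃; proj₁; proj₂)
open import Data.Sum using (_⊎_; inj₁; inj₂)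
open import Data.Vec using (Vec; []; _∷_; fromList)
open import Data.Vec.Base using (here; there)
open import Algebra.Properties.CommutativeSemigroup +-commutativeSemigroup using (x∙yz≈y∙xz)
open import Function.Base using (_∘_)
open import Function.Bundles using (Equivalence)
open import Relation.Binary.PropositionalEquality
open import Relation.Nullary using (¬_)

open Equivalence using (to; from)

private-neighbours⇒IsMTDS : ∀ {n} {G : Graph n} {S : Subset n} → IsTDS G S →
  (∀ u → u ∈ S → ∃ λ v → G v u × (∀ w → w ∈ S → G v w → w ≡ u)) → IsMTDS G S
private-neighbours⇒IsMTDS {G = G} {S} tds priv = tds , minimal
  where
  minimal : ∀ R → R ⊂ S → ¬ IsTDS G R
  minimal R (R⊆S , u , u∈S , u∉R) tdsR with priv u u∈S
  ... | v , _ , only-u with tdsR v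
  ... | w , w∈R , vw = u∉R (subst (_∈ R) (only-u w (R⊆S w∈R) vw) w∈R)

Adjacent : ℕ → ℕ → Set
Adjacent v u = suc v ≡ u ⊎ suc u ≡ v

_‼_ : ∀ {n} → Vec Bool n → ℕ → Bool
[]      ‼ _     = false
(b ∷ _) ‼ zero  = b
(_ ∷ S) ‼ suc k = S ‼ k

∈⇒‼ : ∀ {n} {S : Subset n} {x : Fin n} → x ∈ S → S ‼ toℕ x ≡ true
∈⇒‼ here      = refl
∈⇒‼ (there p) = ∈⇒‼ p

‼⇒∈ : ∀ {n} (S : Subset n) (x : Fin n) → S ‼ toℕ x ≡ true → x ∈ S
‼⇒∈ (_ ∷ _) fzero    refl = here
‼⇒∈ (_ ∷ S) (fsuc x) e    = there (‼⇒∈ S x e)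

‼⇒< : ∀ {n} (S : Subset n) k → S ‼ k ≡ true → k < n
‼⇒< (_ ∷ _) zero    _ = s≤s z≤n
‼⇒< (_ ∷ S) (suc k) e = s≤s (‼⇒< S k e)

Dominates : ∀ {n} → Subset n → Set
Dominates {n} S = ∀ v → v < n → ∃ λ u → S ‼ u ≡ true × Adjacent v u

HasPrivateNeighbours : ∀ {n} → Subset n → Set
HasPrivateNeighbours {n} S = ∀ u → S ‼ u ≡ true →
  ∃ λ v → v < n × Adjacent v u × (∀ w → Adjacent v w → S ‼ w ≡ true → w ≡ u)

isTDS⇒dominates : ∀ {n} {S : Subset n} → IsTDS (PathAdj n) S → Dominates S
isTDS⇒dominates tds v v<n with tds (fromℕ< v<n)
... | u , u∈S , vu = toℕ u , ∈⇒‼ u∈S , subst (λ x → Adjacent x (toℕ u)) (toℕ-fromℕ< v<n) vu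

dominates⇒isTDS : ∀ {n} {S : Subset n} → Dominates S → IsTDS (PathAdj n) S
dominates⇒isTDS {n} {S} dom v with dom (toℕ v) (toℕ<n v)
... | u , Su , vu = fromℕ< u<n , ‼⇒∈ S _ (subst (λ k → S ‼ k ≡ true) (sym (toℕ-fromℕ< u<n)) Su)
                  , subst (Adjacent (toℕ v)) (sym (toℕ-fromℕ< u<n)) vu
  where
  u<n : u < n
  u<n = ‼⇒< S u Su

path-private-neighbours⇒IsMTDS : ∀ {n} {S : Subset n} → Dominates S → HasPrivateNeighbours S →
  IsMTDS (PathAdj n) S
path-private-neighbours⇒IsMTDS {n} {S} dom priv = private-neighbours⇒IsMTDS (dominates⇒isTDS dom) priv′
  where
  priv′ : ∀ u → u ∈ S → ∃ λ v → PathAdj n v u × (∀ w → w ∈ S → PathAdj n v w → w ≡ u)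
  priv′ u u∈S with priv (toℕ u) (∈⇒‼ u∈S)
  ... | v , v<n , vu , only-u =
    fromℕ< v<n , subst (λ x → Adjacent x (toℕ u)) (sym (toℕ-fromℕ< v<n)) vu ,
    λ w w∈S vw → toℕ-injective
      (only-u (toℕ w) (subst (λ x → Adjacent x (toℕ w)) (toℕ-fromℕ< v<n) vw) (∈⇒‼ w∈S))

Cell : Set
Cell = Maybe Bool

inS : Cell → Bool
inS = fromMaybe false

-- The centre c of five consecutive cells (nothing: beyond an end of the path) is dominated,
-- and if c is a member then d or b is a private neighbour of c.
windowOK : Cell → Cell → Cell → Cell → Cell → Bool
windowOK a b nothing  d e = true
windowOK a b (just c) d e =
  (inS b ∨ inS d) ∧ (not c ∨ (is-just d ∧ not (inS e)) ∨ (is-just b ∧ not (inS a)))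

State : Set
State = Cell × Cell × Cell × Cell

start : State
start = nothing , nothing , nothing , nothing

push : State → Cell → State
push (a , b , c , d) e = b , c , d , e

accepts : State → Cell → Bool
accepts (a , b , c , d) e = windowOK a b c d e

check : State → List Bool → Bool
check st []       = true
check st (x ∷ xs) = accepts st (just x) ∧ check (push st (just x)) xs

after : State → List Bool → State
after st []       = st
after st (x ∷ xs) = after (push st (just x)) xs

scan : State → List Bool → Bool
scan st []       = accepts st nothing ∧ accepts (push st nothing) nothing
scan st (x ∷ xs) = accepts st (just x) ∧ scan (push st (just x)) xs

Valid : List Bool → Set
Valid xs = T (scan start xs)

_!_ : List Cell → ℕ → Cell
[]       ! _     = nothing
(c ∷ _)  ! zero  = c
(_ ∷ cs) ! suc k = cs ! k

window : List Cell → ℕ → Bool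
window cs k = windowOK (cs ! k) (cs ! (1 + k)) (cs ! (2 + k)) (cs ! (3 + k)) (cs ! (4 + k))

scan-sound : ∀ a b c d xs → T (scan (a , b , c , d) xs) →
  ∀ k → T (window (a ∷ b ∷ c ∷ d ∷ map just xs) k)
scan-sound a b c d []       ok zero          = proj₁ (to T-∧ ok)
scan-sound a b c d []       ok (suc zero)    = proj₂ (to T-∧ ok)
scan-sound a b c d []       ok (suc (suc k)) = _
scan-sound a b c d (x ∷ xs) ok zero          = proj₁ (to T-∧ ok)
scan-sound a b c d (x ∷ xs) ok (suc k)       = scan-sound b c d (just x) xs (proj₂ (to T-∧ ok)) k

inS-cell : ∀ xs k → inS (map just xs ! k) ≡ fromList xs ‼ k
inS-cell []       k       = refl
inS-cell (x ∷ xs) zero    = refl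
inS-cell (x ∷ xs) (suc k) = inS-cell xs k

is-just-cell : ∀ xs k → T (is-just (map just xs ! k)) → k < length xs
is-just-cell (x ∷ xs) zero    _ = s≤s z≤n
is-just-cell (x ∷ xs) (suc k) p = s≤s (is-just-cell xs k p)

cell-< : ∀ xs k → k < length xs → map just xs ! k ≡ just (fromList xs ‼ k)
cell-< (x ∷ xs) zero    _         = refl
cell-< (x ∷ xs) (suc k) (s≤s k<n) = cell-< xs k k<n

member-cell : ∀ xs k → T (inS (map just xs ! k)) → fromList xs ‼ k ≡ true
member-cell xs k p = trans (sym (inS-cell xs k)) (to T-≡ p)

non-member-cell : ∀ xs k → T (not (inS (map just xs ! k))) → fromList xs ‼ k ≡ false
non-member-cell xs k p = trans (sym (inS-cell xs k)) (to T-not-≡ p)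

windowAround : List Bool → ℕ → Cell → Bool
windowAround xs i c = windowOK ((nothing ∷ nothing ∷ map just xs) ! i) ((nothing ∷ map just xs) ! i)
                               c (map just xs ! suc i) (map just xs ! suc (suc i))

window-at : ∀ xs → Valid xs → ∀ i → i < length xs → T (windowAround xs i (just (fromList xs ‼ i)))
window-at xs ok i i<n =
  subst (T ∘ windowAround xs i) (cell-< xs i i<n) (scan-sound _ _ _ _ xs ok (2 + i))

around-dominated : ∀ xs i {c} → T (windowAround xs i (just c)) →
  T (inS ((nothing ∷ map just xs) ! i)) ⊎ T (inS (map just xs ! suc i))
around-dominated xs i ok = to T-∨ (proj₁ (to T-∧ ok))

around-private : ∀ xs i → T (windowAround xs i (just true)) →
  T (is-just (map just xs ! suc i) ∧ not (inS (map just xs ! suc (suc i)))) ⊎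
  T (is-just ((nothing ∷ map just xs) ! i) ∧ not (inS ((nothing ∷ nothing ∷ map just xs) ! i)))
around-private xs i ok = to T-∨ (proj₂ (to T-∧ ok))

valid⇒dominates : ∀ xs → Valid xs → Dominates (fromList xs)
valid⇒dominates xs ok v v<n with around-dominated xs v {fromList xs ‼ v} (window-at xs ok v v<n)
valid⇒dominates xs ok zero    _ | inj₁ ()
valid⇒dominates xs ok (suc v) _ | inj₁ left  = v , member-cell xs v left , inj₂ refl
valid⇒dominates xs ok v       _ | inj₂ right = suc v , member-cell xs (suc v) right , inj₁ refl

valid⇒private-neighbours : ∀ xs → Valid xs → HasPrivateNeighbours (fromList xs)
valid⇒private-neighbours xs ok u Su
  with around-private xs u
         (subst (T ∘ windowAround xs u ∘ just) Su (window-at xs ok u (‼⇒< (fromList xs) u Su)))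
... | inj₁ right = suc u , is-just-cell xs (suc u) (proj₁ (to T-∧ right)) , inj₂ refl , only-u
  where
  only-u : ∀ w → Adjacent (suc u) w → fromList xs ‼ w ≡ true → w ≡ u
  only-u w (inj₁ refl) Sw = ⊥-elim (not-¬ Sw (non-member-cell xs w (proj₂ (to T-∧ right))))
  only-u w (inj₂ refl) _  = refl
valid⇒private-neighbours xs ok zero    Su | inj₂ ()
valid⇒private-neighbours xs ok (suc u) Su | inj₂ left =
  u , is-just-cell xs u (proj₁ (to T-∧ left)) , inj₁ refl , only-u
  where
  only-u : ∀ w → Adjacent u w → fromList xs ‼ w ≡ true → w ≡ suc u
  only-u w (inj₁ u+1≡w) _  = sym u+1≡w
  only-u w (inj₂ w+1≡u) Sw = ⊥-elim (not-¬ Sw (non-member-cell xs w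
    (subst (λ k → T (not (inS ((nothing ∷ map just xs) ! k)))) (sym w+1≡u) (proj₂ (to T-∧ left)))))

UpperBound : ℕ → ℕ → ℕ → Set
UpperBound n i k = ∃ λ xs → length xs ≡ n × Valid xs × fromList xs ‼ i ≡ true × ∣ fromList xs ∣ ≡ k

LowerBound : ℕ → ℕ → ℕ → Set
LowerBound n i k = (S : Subset n) → Dominates S → S ‼ i ≡ true → k ≤ ∣ S ∣

Bounds : ℕ → ℕ → ℕ → Set
Bounds n i k = UpperBound n i k × LowerBound n i k

degree-from-bounds : ∀ {n} (a : Fin n) {k} → Bounds n (toℕ a) k → TDDegreeIs (PathAdj n) a k
degree-from-bounds a ((xs , refl , valid , a∈xs , size) , lower) =
  (fromList xs , mtds , ‼⇒∈ (fromList xs) a a∈xs , size) ,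
  λ S S-mtds a∈S → lower S (isTDS⇒dominates (proj₁ S-mtds)) (∈⇒‼ a∈S)
  where
  mtds : IsMTDS (PathAdj (length xs)) (fromList xs)
  mtds = path-private-neighbours⇒IsMTDS (valid⇒dominates xs valid) (valid⇒private-neighbours xs valid)

rep : List Bool → ℕ → List Bool → List Bool
rep w zero    X = X
rep w (suc k) X = w ++ rep w k X

scan-++ : ∀ st w r → T (check st w) → T (scan (after st w) r) → T (scan st (w ++ r))
scan-++ st []       r _  ok = ok
scan-++ st (x ∷ xs) r ok ok′ =
  from T-∧ (proj₁ (to T-∧ ok) , scan-++ (push st (just x)) xs r (proj₂ (to T-∧ ok)) ok′)

scan-cycle : ∀ st w X k → T (check st w) → after st w ≡ st → T (scan st X) → T (scan st (rep w k X))
scan-cycle st w X zero    _  _   ok = ok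
scan-cycle st w X (suc k) ok cyc ok′ = scan-++ st w (rep w k X) ok
  (subst (λ st′ → T (scan st′ (rep w k X))) (sym cyc) (scan-cycle st w X k ok cyc ok′))

scan-rep⁺ : ∀ st w X k → T (check st w) → T (check (after st w) w) → after (after st w) w ≡ after st w →
  T (scan (after st w) X) → T (scan st (rep w (suc k) X))
scan-rep⁺ st w X k entry ok cyc ok′ =
  scan-++ st w (rep w k X) entry (scan-cycle (after st w) w X k ok cyc ok′)

scan-rep : ∀ st w X k → T (check st w) → T (check (after st w) w) → after (after st w) w ≡ after st w →
  T (scan st X) → T (scan (after st w) X) → T (scan st (rep w k X))
scan-rep st w X zero    _     _  _   ok _   = ok
scan-rep st w X (suc k) entry ok cyc _  ok′ = scan-rep⁺ st w X k entry ok cyc ok′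

length-rep : ∀ w k X → length (rep w k X) ≡ k * length w + length X
length-rep w zero    X = refl
length-rep w (suc k) X = begin
  length (w ++ rep w k X)                   ≡⟨ length-++ w ⟩
  length w + length (rep w k X)             ≡⟨ cong (length w +_) (length-rep w k X) ⟩
  length w + (k * length w + length X)      ≡⟨ +-assoc (length w) _ _ ⟨
  length w + k * length w + length X        ∎
  where open ≡-Reasoning

size-++ : ∀ u v → ∣ fromList (u ++ v) ∣ ≡ ∣ fromList u ∣ + ∣ fromList v ∣
size-++ []          v = refl
size-++ (true ∷ u)  v = cong suc (size-++ u v)
size-++ (false ∷ u) v = size-++ u v

size-rep : ∀ w k X → ∣ fromList (rep w k X) ∣ ≡ k * ∣ fromList w ∣ + ∣ fromList X ∣
size-rep w zero    X = refl
size-rep w (suc k) X = begin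
  ∣ fromList (w ++ rep w k X) ∣                         ≡⟨ size-++ w _ ⟩
  ∣ fromList w ∣ + ∣ fromList (rep w k X) ∣             ≡⟨ cong (∣ fromList w ∣ +_) (size-rep w k X) ⟩
  ∣ fromList w ∣ + (k * ∣ fromList w ∣ + ∣ fromList X ∣) ≡⟨ +-assoc ∣ fromList w ∣ _ _ ⟨
  ∣ fromList w ∣ + k * ∣ fromList w ∣ + ∣ fromList X ∣   ∎
  where open ≡-Reasoning

‼-++ : ∀ u v t → fromList (u ++ v) ‼ (length u + t) ≡ fromList v ‼ t
‼-++ []      v t = refl
‼-++ (x ∷ u) v t = ‼-++ u v t

‼-rep : ∀ w X t j k → fromList (rep w (j + k) X) ‼ (t + j * length w) ≡ fromList (rep w k X) ‼ t
‼-rep w X t zero    k = cong (fromList (rep w k X) ‼_) (+-identityʳ t)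
‼-rep w X t (suc j) k = begin
  fromList (w ++ rep w (j + k) X) ‼ (t + (length w + j * length w))
    ≡⟨ cong (fromList (w ++ rep w (j + k) X) ‼_) (x∙yz≈y∙xz t (length w) _) ⟩
  fromList (w ++ rep w (j + k) X) ‼ (length w + (t + j * length w))
    ≡⟨ ‼-++ w _ _ ⟩
  fromList (rep w (j + k) X) ‼ (t + j * length w)
    ≡⟨ ‼-rep w X t j k ⟩
  fromList (rep w k X) ‼ t ∎
  where open ≡-Reasoning

‼-rep-end : ∀ w X t j → fromList (rep w j X) ‼ (t + j * length w) ≡ fromList X ‼ t
‼-rep-end w X t j =
  subst (λ k → fromList (rep w k X) ‼ (t + j * length w) ≡ fromList X ‼ t) (+-identityʳ j) (‼-rep w X t j 0)

‼-rep-< : ∀ w X t {j k} → (∀ Y → fromList (w ++ Y) ‼ t ≡ true) → j < k →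
  fromList (rep w k X) ‼ (t + j * length w) ≡ true
‼-rep-< w X t {j} in-w j<k with m≤n⇒∃[o]m+o≡n j<k
... | m , refl = trans (subst (λ k → fromList (rep w k X) ‼ (t + j * length w) ≡ fromList (rep w (suc m) X) ‼ t)
                              (+-suc j m) (‼-rep w X t j (suc m)))
                       (in-w _)

‼-rep-≤ : ∀ w X t {j k} → (∀ Y → fromList (w ++ Y) ‼ t ≡ true) → fromList X ‼ t ≡ true → j ≤ k →
  fromList (rep w k X) ‼ (t + j * length w) ≡ true
‼-rep-≤ w X t {j} in-w in-X j≤k with m≤n⇒m<n∨m≡n j≤k
... | inj₁ j<k  = ‼-rep-< w X t in-w j<k
... | inj₂ refl = trans (‼-rep-end w X t j) in-X

‼-prefix-rep : ∀ u w X t {j k} → length u ≡ length w → (∀ Y → fromList (u ++ Y) ‼ t ≡ true) →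
  (∀ Y → fromList (w ++ Y) ‼ t ≡ true) → j ≤ k → fromList (u ++ rep w k X) ‼ (t + j * length w) ≡ true
‼-prefix-rep u w X t {zero}  {k} _   in-u _    _   =
  trans (cong (fromList (u ++ rep w k X) ‼_) (+-identityʳ t)) (in-u _)
‼-prefix-rep u w X t {suc j} {k} |u| _    in-w j<k = begin
  fromList (u ++ rep w k X) ‼ (t + (length w + j * length w))
    ≡⟨ cong (fromList (u ++ rep w k X) ‼_) (x∙yz≈y∙xz t (length w) _) ⟩
  fromList (u ++ rep w k X) ‼ (length w + (t + j * length w))
    ≡⟨ cong (λ L → fromList (u ++ rep w k X) ‼ (L + (t + j * length w))) (sym |u|) ⟩
  fromList (u ++ rep w k X) ‼ (length u + (t + j * length w))
    ≡⟨ ‼-++ u _ _ ⟩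
  fromList (rep w k X) ‼ (t + j * length w)
    ≡⟨ ‼-rep-< w X t in-w j<k ⟩
  true ∎
  where open ≡-Reasoning

pattern ● = true
pattern ○ = false

upper-4q-4j+t : ∀ q t j → (∀ Y → fromList (○ ∷ ● ∷ ● ∷ ○ ∷ Y) ‼ t ≡ true) → j < q →
  UpperBound (q * 4) (t + j * 4) (q * 2)
upper-4q-4j+t q t j in-w j<q =
  rep w q [] , trans (length-rep w q []) (+-identityʳ _) , scan-rep start w [] q _ _ refl _ _ ,
  ‼-rep-< w [] t in-w j<q , trans (size-rep w q []) (+-identityʳ _)
  where
  w : List Bool
  w = ○ ∷ ● ∷ ● ∷ ○ ∷ []

upper-4q-4j : ∀ q j → 2 ≤ q → j < q → UpperBound (q * 4) (j * 4) (q * 2 + 1)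
upper-4q-4j (suc zero) j (s≤s ()) _
upper-4q-4j (suc (suc q)) j _ j<q =
  rep w (suc q) X , trans (length-rep w (suc q) X) (length≡ q) , scan-rep⁺ start w X q _ _ refl _ ,
  ‼-rep-≤ w X 0 (λ _ → refl) refl (≤-pred j<q) , trans (size-rep w (suc q) X) (size≡ q)
  where
  w X : List Bool
  w = ● ∷ ● ∷ ○ ∷ ○ ∷ []
  X = ● ∷ ● ∷ ● ∷ ○ ∷ []
  length≡ : ∀ q → suc q * 4 + 4 ≡ suc (suc q) * 4
  length≡ = solve-∀
  size≡ : ∀ q → suc q * 2 + 3 ≡ suc (suc q) * 2 + 1
  size≡ = solve-∀

upper-4q-4j+3 : ∀ q j → 2 ≤ q → j < q → UpperBound (q * 4) (3 + j * 4) (q * 2 + 1)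
upper-4q-4j+3 (suc zero) j (s≤s ()) _
upper-4q-4j+3 (suc (suc q)) j _ j<q =
  u ++ rep w (suc q) [] , trans (cong (4 +_) (length-rep w (suc q) [])) (length≡ q) ,
  scan-rep⁺ (after start u) w [] q _ _ refl _ ,
  ‼-prefix-rep u w [] 3 refl (λ _ → refl) (λ _ → refl) (≤-pred j<q) ,
  trans (cong (3 +_) (size-rep w (suc q) [])) (size≡ q)
  where
  u w : List Bool
  u = ○ ∷ ● ∷ ● ∷ ● ∷ []
  w = ○ ∷ ○ ∷ ● ∷ ● ∷ []
  length≡ : ∀ q → 4 + (suc q * 4 + 0) ≡ suc (suc q) * 4
  length≡ = solve-∀
  size≡ : ∀ q → 3 + (suc q * 2 + 0) ≡ suc (suc q) * 2 + 1
  size≡ = solve-∀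

upper-4q+1-4j+t : ∀ q t j → (∀ Y → fromList (○ ∷ ● ∷ ● ∷ ○ ∷ Y) ‼ t ≡ true) →
  fromList (○ ∷ ● ∷ ● ∷ ● ∷ ○ ∷ []) ‼ t ≡ true → j < q → UpperBound (1 + q * 4) (t + j * 4) (1 + q * 2)
upper-4q+1-4j+t (suc q) t j in-w in-X j<q =
  rep w q X , trans (length-rep w q X) (length≡ q) , scan-rep start w X q _ _ refl _ _ ,
  ‼-rep-≤ w X t in-w in-X (≤-pred j<q) , trans (size-rep w q X) (size≡ q)
  where
  w X : List Bool
  w = ○ ∷ ● ∷ ● ∷ ○ ∷ []
  X = ○ ∷ ● ∷ ● ∷ ● ∷ ○ ∷ []
  length≡ : ∀ q → q * 4 + 5 ≡ 1 + suc q * 4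
  length≡ = solve-∀
  size≡ : ∀ q → q * 2 + 3 ≡ 1 + suc q * 2
  size≡ = solve-∀

upper-4q+1-4j+3 : ∀ q j → j < q → UpperBound (1 + q * 4) (3 + j * 4) (1 + q * 2)
upper-4q+1-4j+3 (suc q) j j<q =
  u ++ rep w q X , trans (cong (4 +_) (length-rep w q X)) (length≡ q) ,
  scan-rep (after start u) w X q _ _ refl _ _ ,
  ‼-prefix-rep u w X 3 refl (λ _ → refl) (λ _ → refl) (≤-pred j<q) ,
  trans (cong (3 +_) (size-rep w q X)) (size≡ q)
  where
  u w X : List Bool
  u = ○ ∷ ● ∷ ● ∷ ● ∷ []
  w = ○ ∷ ○ ∷ ● ∷ ● ∷ []
  X = ○ ∷ []
  length≡ : ∀ q → 4 + (q * 4 + 1) ≡ 1 + suc q * 4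
  length≡ = solve-∀
  size≡ : ∀ q → 3 + (q * 2 + 0) ≡ 1 + suc q * 2
  size≡ = solve-∀

upper-4q+1-4j : ∀ q j → 1 ≤ q → j ≤ q → UpperBound (1 + q * 4) (j * 4) (1 + q * 2 + 1)
upper-4q+1-4j q j _ j≤q with m≤n⇒m<n∨m≡n j≤q
upper-4q+1-4j (suc q) .(suc q) _ _ | inj₂ refl =
  rep w q X , trans (length-rep w q X) (length≡ q) , scan-rep start w X q _ _ refl _ _ ,
  trans (‼-rep-end w X 4 q) refl , trans (size-rep w q X) (size≡ q)
  where
  w X : List Bool
  w = ● ∷ ● ∷ ○ ∷ ○ ∷ []
  X = ● ∷ ● ∷ ○ ∷ ● ∷ ● ∷ []
  length≡ : ∀ q → q * 4 + 5 ≡ 1 + suc q * 4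
  length≡ = solve-∀
  size≡ : ∀ q → q * 2 + 4 ≡ 1 + suc q * 2 + 1
  size≡ = solve-∀
upper-4q+1-4j q j _ _ | inj₁ j<q with m≤n⇒∃[o]m+o≡n j<q
... | k , refl =
  rep w j X , trans (length-rep w j X) (trans (cong (λ L → j * 4 + (4 + L)) (length-rep v k Y)) (length≡ j k)) ,
  scan-rep start w X j _ _ refl X-valid X-valid ,
  trans (‼-rep-end w X 0 j) refl ,
  trans (size-rep w j X) (trans (cong (λ c → j * 2 + (3 + c)) (size-rep v k Y)) (size≡ j k))
  where
  w u v Y X : List Bool
  w = ○ ∷ ● ∷ ● ∷ ○ ∷ []
  u = ● ∷ ● ∷ ○ ∷ ● ∷ []
  v = ● ∷ ○ ∷ ○ ∷ ● ∷ []
  Y = ● ∷ []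
  X = u ++ rep v k Y
  X-valid : T (scan (after start u) (rep v k Y))
  X-valid = scan-rep (after start u) v Y k _ _ refl _ _
  length≡ : ∀ j k → j * 4 + (4 + (k * 4 + 1)) ≡ 1 + suc (j + k) * 4
  length≡ = solve-∀
  size≡ : ∀ j k → j * 2 + (3 + (k * 2 + 1)) ≡ 1 + suc (j + k) * 2 + 1
  size≡ = solve-∀

upper-4q+2-4j+t : ∀ q t j → (∀ Y → fromList (● ∷ ● ∷ ○ ∷ ○ ∷ Y) ‼ t ≡ true) →
  fromList (● ∷ ● ∷ []) ‼ t ≡ true → j ≤ q → UpperBound (2 + q * 4) (t + j * 4) (1 + q * 2 + 1)
upper-4q+2-4j+t q t j in-w in-X j≤q =
  rep w q X , trans (length-rep w q X) (length≡ q) , scan-rep start w X q _ _ refl _ _ ,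
  ‼-rep-≤ w X t in-w in-X j≤q , trans (size-rep w q X) (size≡ q)
  where
  w X : List Bool
  w = ● ∷ ● ∷ ○ ∷ ○ ∷ []
  X = ● ∷ ● ∷ []
  length≡ : ∀ q → q * 4 + 2 ≡ 2 + q * 4
  length≡ = solve-∀
  size≡ : ∀ q → q * 2 + 2 ≡ 1 + q * 2 + 1
  size≡ = solve-∀

upper-4q+2-4j+t′ : ∀ q t j → (∀ Y → fromList (○ ∷ ● ∷ ● ∷ ● ∷ Y) ‼ t ≡ true) →
  (∀ Y → fromList (○ ∷ ○ ∷ ● ∷ ● ∷ Y) ‼ t ≡ true) → j < q → UpperBound (2 + q * 4) (t + j * 4) (1 + q * 2 + 1)
upper-4q+2-4j+t′ (suc q) t j in-u in-w j<q =
  u ++ rep w q X , trans (cong (4 +_) (length-rep w q X)) (length≡ q) ,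
  scan-rep (after start u) w X q _ _ refl _ _ ,
  ‼-prefix-rep u w X t refl in-u in-w (≤-pred j<q) ,
  trans (cong (3 +_) (size-rep w q X)) (size≡ q)
  where
  u w X : List Bool
  u = ○ ∷ ● ∷ ● ∷ ● ∷ []
  w = ○ ∷ ○ ∷ ● ∷ ● ∷ []
  X = ● ∷ ○ ∷ []
  length≡ : ∀ q → 4 + (q * 4 + 2) ≡ 2 + suc q * 4
  length≡ = solve-∀
  size≡ : ∀ q → 3 + (q * 2 + 1) ≡ 1 + suc q * 2 + 1
  size≡ = solve-∀

upper-4q+3-4j+t : ∀ q t j → (∀ Y → fromList (● ∷ ● ∷ ○ ∷ ○ ∷ Y) ‼ t ≡ true) →
  fromList (● ∷ ● ∷ ○ ∷ []) ‼ t ≡ true → j ≤ q → UpperBound (3 + q * 4) (t + j * 4) (2 + q * 2)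
upper-4q+3-4j+t q t j in-w in-X j≤q =
  rep w q X , trans (length-rep w q X) (+-comm (q * 4) 3) , scan-rep start w X q _ _ refl _ _ ,
  ‼-rep-≤ w X t in-w in-X j≤q , trans (size-rep w q X) (+-comm (q * 2) 2)
  where
  w X : List Bool
  w = ● ∷ ● ∷ ○ ∷ ○ ∷ []
  X = ● ∷ ● ∷ ○ ∷ []

upper-4q+3-4j+t′ : ∀ q t j → (∀ Y → fromList (○ ∷ ● ∷ ● ∷ ○ ∷ Y) ‼ t ≡ true) →
  fromList (○ ∷ ● ∷ ● ∷ []) ‼ t ≡ true → j ≤ q → UpperBound (3 + q * 4) (t + j * 4) (2 + q * 2)
upper-4q+3-4j+t′ q t j in-w in-X j≤q =
  rep w q X , trans (length-rep w q X) (+-comm (q * 4) 3) , scan-rep start w X q _ _ refl _ _ ,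
  ‼-rep-≤ w X t in-w in-X j≤q , trans (size-rep w q X) (+-comm (q * 2) 2)
  where
  w X : List Bool
  w = ○ ∷ ● ∷ ● ∷ ○ ∷ []
  X = ○ ∷ ● ∷ ● ∷ []

upper-4q+3-4j+3 : ∀ q j → q ≢ 1 → j < q → UpperBound (3 + q * 4) (3 + j * 4) (2 + q * 2 + 1)
upper-4q+3-4j+3 q j q≢1 j<q with m≤n⇒∃[o]m+o≡n j<q
upper-4q+3-4j+3 _ zero    q≢1 _ | zero , refl = ⊥-elim (q≢1 refl)
upper-4q+3-4j+3 _ (suc j) _   _ | zero , refl =
  u ++ rep w (suc j) X , trans (cong (4 +_) (length-rep w (suc j) X)) (length≡ j) ,
  scan-rep⁺ (after start u) w X j _ _ refl _ ,
  ‼-prefix-rep u w X 3 {suc j} refl (λ _ → refl) (λ _ → refl) ≤-refl ,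
  trans (cong (3 +_) (size-rep w (suc j) X)) (size≡ j)
  where
  u w X : List Bool
  u = ○ ∷ ● ∷ ● ∷ ● ∷ []
  w = ○ ∷ ○ ∷ ● ∷ ● ∷ []
  X = ○ ∷ ● ∷ ● ∷ []
  length≡ : ∀ j → 4 + (suc j * 4 + 3) ≡ 3 + suc (suc j + 0) * 4
  length≡ = solve-∀
  size≡ : ∀ j → 3 + (suc j * 2 + 2) ≡ 2 + suc (suc j + 0) * 2 + 1
  size≡ = solve-∀
upper-4q+3-4j+3 _ j _ _ | suc k , refl =
  rep w j X , trans (length-rep w j X) (trans (cong (λ L → j * 4 + (4 + L)) (length-rep v (suc k) Y)) (length≡ j k)) ,
  scan-rep start w X j _ _ refl X-valid X-valid ,
  trans (‼-rep-end w X 3 j) refl ,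
  trans (size-rep w j X) (trans (cong (λ c → j * 2 + (3 + c)) (size-rep v (suc k) Y)) (size≡ j k))
  where
  w u v Y X : List Bool
  w = ● ∷ ● ∷ ○ ∷ ○ ∷ []
  u = ● ∷ ● ∷ ○ ∷ ● ∷ []
  v = ● ∷ ○ ∷ ○ ∷ ● ∷ []
  Y = ● ∷ ● ∷ ○ ∷ []
  X = u ++ rep v (suc k) Y
  X-valid : T (scan (after start u) (rep v (suc k) Y))
  X-valid = scan-rep⁺ (after start u) v Y k _ _ refl _
  length≡ : ∀ j k → j * 4 + (4 + (suc k * 4 + 3)) ≡ 3 + suc (j + suc k) * 4
  length≡ = solve-∀
  size≡ : ∀ j k → j * 2 + (3 + (suc k * 2 + 2)) ≡ 2 + suc (j + suc k) * 2 + 1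
  size≡ = solve-∀

bit : Bool → ℕ
bit true  = 1
bit false = 0

countFrom : ∀ {n} → Subset n → ℕ → ℕ → ℕ
countFrom S p zero    = 0
countFrom S p (suc L) = bit (S ‼ p) + countFrom S (suc p) L

countFrom-∷ : ∀ {n} b (S : Subset n) p L → countFrom (b ∷ S) (suc p) L ≡ countFrom S p L
countFrom-∷ b S p zero    = refl
countFrom-∷ b S p (suc L) = cong (bit (S ‼ p) +_) (countFrom-∷ b S (suc p) L)

∣∣≡countFrom : ∀ {n} (S : Subset n) → ∣ S ∣ ≡ countFrom S 0 n
∣∣≡countFrom []                = refl
∣∣≡countFrom {suc n} (true ∷ S)  = cong suc (trans (∣∣≡countFrom S) (sym (countFrom-∷ true S 0 n)))
∣∣≡countFrom {suc n} (false ∷ S) = trans (∣∣≡countFrom S) (sym (countFrom-∷ false S 0 n))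

countFrom-+ : ∀ {n} (S : Subset n) p L M → countFrom S p (L + M) ≡ countFrom S p L + countFrom S (p + L) M
countFrom-+ S p zero    M = cong (λ q → countFrom S q M) (sym (+-identityʳ p))
countFrom-+ S p (suc L) M = begin
  bit (S ‼ p) + countFrom S (suc p) (L + M)
    ≡⟨ cong (bit (S ‼ p) +_) (countFrom-+ S (suc p) L M) ⟩
  bit (S ‼ p) + (countFrom S (suc p) L + countFrom S (suc p + L) M)
    ≡⟨ +-assoc (bit (S ‼ p)) _ _ ⟨
  bit (S ‼ p) + countFrom S (suc p) L + countFrom S (suc p + L) M
    ≡⟨ cong (λ q → bit (S ‼ p) + countFrom S (suc p) L + countFrom S q M) (+-suc p L) ⟨
  bit (S ‼ p) + countFrom S (suc p) L + countFrom S (p + suc L) M ∎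
  where open ≡-Reasoning

one-of-two : ∀ {b c} → b ≡ true ⊎ c ≡ true → 1 ≤ bit b + bit c
one-of-two         (inj₁ refl) = s≤s z≤n
one-of-two {true}  (inj₂ refl) = s≤s z≤n
one-of-two {false} (inj₂ refl) = s≤s z≤n

bit-true : ∀ {b} → b ≡ true → 1 ≤ bit b
bit-true refl = ≤-refl

two-of-two : ∀ a b → 1 ≤ a → 1 ≤ b → 2 ≤ a + (b + 0)
two-of-two a b 1≤a 1≤b = subst (2 ≤_) (cong (a +_) (sym (+-identityʳ b))) (+-mono-≤ 1≤a 1≤b)

two-of-three : ∀ a b c → 1 ≤ b → 1 ≤ a + c → 2 ≤ a + (b + (c + 0))
two-of-three a b c 1≤b 1≤a+c = subst (2 ≤_) (rearrange a b c) (+-mono-≤ 1≤b 1≤a+c)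
  where
  rearrange : ∀ a b c → b + (a + c) ≡ a + (b + (c + 0))
  rearrange = solve-∀

two-of-four : ∀ a b c d → 1 ≤ a + c → 1 ≤ b + d → 2 ≤ a + (b + (c + (d + 0)))
two-of-four a b c d 1≤a+c 1≤b+d = subst (2 ≤_) (rearrange a b c d) (+-mono-≤ 1≤a+c 1≤b+d)
  where
  rearrange : ∀ a b c d → (a + c) + (b + d) ≡ a + (b + (c + (d + 0)))
  rearrange = solve-∀

module Pieces {n} (S : Subset n) (dom : Dominates S) where

  -- At least k members among p, …, p + L − 1, as long as these end at most one vertex past the
  -- path: a block of four only needs its two middle vertices on the path.
  record Piece (p L k : ℕ) : Set where
    constructor piece
    field within : L + p ≤ suc n → k ≤ countFrom S p L
  open Piece

  infixl 5 _⊕_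
  _⊕_ : ∀ {p L M k l} → Piece p L k → Piece (p + L) M l → Piece p (L + M) (k + l)
  _⊕_ {p} {L} {M} left right = piece λ L+M+p≤ →
    subst (_ ≤_) (sym (countFrom-+ S p L M))
          (+-mono-≤ (within left (≤-trans (+-monoˡ-≤ p (m≤m+n L M)) L+M+p≤))
                    (within right (subst (_≤ suc n) (regroup L M p) L+M+p≤)))
    where
    regroup : ∀ L M p → L + M + p ≡ M + (p + L)
    regroup = solve-∀

  total : ∀ {L k m} → Piece 0 L k → L ≡ n → k ≡ m → m ≤ ∣ S ∣
  total {k = k} (piece k≤) refl refl =
    subst (k ≤_) (sym (∣∣≡countFrom S)) (k≤ (≤-trans (≤-reflexive (+-identityʳ n)) (n≤1+n n)))

  bitAt : ℕ → ℕ
  bitAt k = bit (S ‼ k)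

  dominator : ∀ v → suc v < n → S ‼ v ≡ true ⊎ S ‼ suc (suc v) ≡ true
  dominator v v+1<n with dom (suc v) v+1<n
  ... | u , Su , inj₁ refl = inj₂ Su
  ... | u , Su , inj₂ refl = inj₁ Su

  first-dominator : 0 < n → S ‼ 1 ≡ true
  first-dominator 0<n with dom 0 0<n
  ... | u , Su , inj₁ refl = Su

  last-dominator : ∀ v → 2 + v ≡ n → S ‼ v ≡ true
  last-dominator v refl with dom (suc v) ≤-refl
  ... | u , Su , inj₁ refl = ⊥-elim (<-irrefl refl (‼⇒< S u Su))
  ... | u , Su , inj₂ refl = Su

  block : ∀ p → Piece p 4 2
  block p = piece λ 4+p≤ →
    two-of-four (bitAt p) (bitAt (1 + p)) (bitAt (2 + p)) (bitAt (3 + p))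
                (one-of-two (dominator p (≤-trans (n≤1+n _) (≤-pred 4+p≤))))
                (one-of-two (dominator (suc p) (≤-pred 4+p≤)))

  blocks : ∀ k p → Piece p (k * 4) (k * 2)
  blocks zero    p = piece λ _ → z≤n
  blocks (suc k) p = block p ⊕ blocks k (p + 4)

  head : Piece 0 3 2
  head = piece λ 3≤n+1 →
    two-of-three (bitAt 0) (bitAt 1) (bitAt 2) (bit-true (first-dominator (≤-trans (s≤s z≤n) (≤-pred 3≤n+1))))
                 (one-of-two (dominator 0 (≤-pred 3≤n+1)))

  head-dominated : Piece 0 2 1
  head-dominated = piece λ 2≤n+1 →
    ≤-trans (bit-true (first-dominator (≤-pred 2≤n+1))) (≤-trans (m≤m+n (bitAt 1) 0) (m≤n+m _ (bitAt 0)))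

  head-member : S ‼ 0 ≡ true → Piece 0 2 2
  head-member S0 = piece λ 2≤n+1 →
    two-of-two (bitAt 0) (bitAt 1) (bit-true S0) (bit-true (first-dominator (≤-pred 2≤n+1)))

  member : ∀ p → S ‼ p ≡ true → Piece p 1 1
  member p Sp = piece λ _ → ≤-trans (bit-true Sp) (m≤m+n (bitAt p) 0)

  around-member : ∀ p → S ‼ suc p ≡ true → Piece p 3 2
  around-member p Sp+1 = piece λ 3+p≤ →
    two-of-three (bitAt p) (bitAt (1 + p)) (bitAt (2 + p)) (bit-true Sp+1)
                 (one-of-two (dominator p (≤-pred 3+p≤)))

  tail : ∀ p → p + 3 ≡ n → Piece p 3 2
  tail p p+3≡n = piece λ _ →
    two-of-three (bitAt p) (bitAt (1 + p)) (bitAt (2 + p)) (bit-true (last-dominator (suc p) 3+p≡n))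
                 (one-of-two (dominator p (subst (suc (suc p) ≤_) 3+p≡n (n≤1+n _))))
    where
    3+p≡n : 3 + p ≡ n
    3+p≡n = trans (+-comm 3 p) p+3≡n

  tail-member : ∀ p → S ‼ suc p ≡ true → p + 2 ≡ n → Piece p 2 2
  tail-member p Sp+1 p+2≡n = piece λ _ →
    two-of-two (bitAt p) (bitAt (1 + p)) (bit-true (last-dominator p (trans (+-comm 2 p) p+2≡n))) (bit-true Sp+1)

-- The case lemmas are named after the shapes of n and of the 0-based index i of the vertex:
-- lower-4q+1-4j+3 is about n = 4q + 1 and the vertex a_{4j+4}.
lower-4q : ∀ q i → LowerBound (q * 4) i (q * 2)
lower-4q q i S dom _ = total (blocks q 0) refl refl
  where open Pieces S dom

lower-4q-4j : ∀ q j → j < q → LowerBound (q * 4) (j * 4) (q * 2 + 1)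
lower-4q-4j q j j<q with m≤n⇒∃[o]m+o≡n j<q
... | k , refl = λ S dom Sj →
  let open Pieces S dom in
  total (blocks j 0 ⊕ member (j * 4) Sj ⊕ blocks k (j * 4 + 1) ⊕ tail (j * 4 + 1 + k * 4) (length≡ j k))
        (length≡ j k) (size≡ j k)
  where
  length≡ : ∀ j k → j * 4 + 1 + k * 4 + 3 ≡ suc (j + k) * 4
  length≡ = solve-∀
  size≡ : ∀ j k → j * 2 + 1 + k * 2 + 2 ≡ suc (j + k) * 2 + 1
  size≡ = solve-∀

lower-4q-4j+3 : ∀ q j → j < q → LowerBound (q * 4) (3 + j * 4) (q * 2 + 1)
lower-4q-4j+3 q j j<q with m≤n⇒∃[o]m+o≡n j<q
... | k , refl = λ S dom Sj →
  let open Pieces S dom in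
  total (head ⊕ blocks j 3 ⊕ member (3 + j * 4) Sj ⊕ blocks k (3 + j * 4 + 1)) (length≡ j k) (size≡ j k)
  where
  length≡ : ∀ j k → 3 + j * 4 + 1 + k * 4 ≡ suc (j + k) * 4
  length≡ = solve-∀
  size≡ : ∀ j k → 2 + j * 2 + 1 + k * 2 ≡ suc (j + k) * 2 + 1
  size≡ = solve-∀

lower-4q+1 : ∀ q i → 1 ≤ q → LowerBound (1 + q * 4) i (1 + q * 2)
lower-4q+1 (suc q) i _ S dom _ =
  total (head-dominated ⊕ blocks q 2 ⊕ tail (2 + q * 4) (length≡ q)) (length≡ q) (size≡ q)
  where
  open Pieces S dom
  length≡ : ∀ q → 2 + q * 4 + 3 ≡ 1 + suc q * 4
  length≡ = solve-∀
  size≡ : ∀ q → 1 + q * 2 + 2 ≡ 1 + suc q * 2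
  size≡ = solve-∀

lower-4q+1-4j : ∀ q j → 1 ≤ q → j ≤ q → LowerBound (1 + q * 4) (j * 4) (1 + q * 2 + 1)
lower-4q+1-4j (suc q) zero _ _ S dom S0 =
  total (head-member S0 ⊕ blocks q 2 ⊕ tail (2 + q * 4) (length≡ q)) (length≡ q) (size≡ q)
  where
  open Pieces S dom
  length≡ : ∀ q → 2 + q * 4 + 3 ≡ 1 + suc q * 4
  length≡ = solve-∀
  size≡ : ∀ q → 2 + q * 2 + 2 ≡ 1 + suc q * 2 + 1
  size≡ = solve-∀
lower-4q+1-4j q (suc j) _ j≤q with m≤n⇒m<n∨m≡n j≤q
... | inj₂ refl = λ S dom Sj →
  let open Pieces S dom in
  total (head ⊕ blocks j 3 ⊕ tail-member (3 + j * 4) Sj (length≡ j)) (length≡ j) (size≡ j)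
  where
  length≡ : ∀ j → 3 + j * 4 + 2 ≡ 1 + suc j * 4
  length≡ = solve-∀
  size≡ : ∀ j → 2 + j * 2 + 2 ≡ 1 + suc j * 2 + 1
  size≡ = solve-∀
... | inj₁ j<q with m≤n⇒∃[o]m+o≡n j<q
...   | k , refl = λ S dom Sj →
  let open Pieces S dom in
  total (head ⊕ blocks j 3 ⊕ around-member (3 + j * 4) Sj ⊕ blocks k (3 + j * 4 + 3)
              ⊕ tail (3 + j * 4 + 3 + k * 4) (length≡ j k))
        (length≡ j k) (size≡ j k)
  where
  length≡ : ∀ j k → 3 + j * 4 + 3 + k * 4 + 3 ≡ 1 + (2 + j + k) * 4
  length≡ = solve-∀
  size≡ : ∀ j k → 2 + j * 2 + 2 + k * 2 + 2 ≡ 1 + (2 + j + k) * 2 + 1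
  size≡ = solve-∀

lower-4q+2 : ∀ q i → LowerBound (2 + q * 4) i (1 + q * 2 + 1)
lower-4q+2 zero    i S dom _ = total (tail-member 0 (first-dominator (s≤s z≤n)) refl) refl refl
  where open Pieces S dom
lower-4q+2 (suc q) i S dom _ =
  total (head ⊕ blocks q 3 ⊕ tail (3 + q * 4) (length≡ q)) (length≡ q) (size≡ q)
  where
  open Pieces S dom
  length≡ : ∀ q → 3 + q * 4 + 3 ≡ 2 + suc q * 4
  length≡ = solve-∀
  size≡ : ∀ q → 2 + q * 2 + 2 ≡ 1 + suc q * 2 + 1
  size≡ = solve-∀

lower-4q+3 : ∀ q i → LowerBound (3 + q * 4) i (2 + q * 2)
lower-4q+3 q i S dom _ = total (head ⊕ blocks q 3) refl refl
  where open Pieces S dom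

lower-4q+3-4j+3 : ∀ q j → j < q → LowerBound (3 + q * 4) (3 + j * 4) (2 + q * 2 + 1)
lower-4q+3-4j+3 q j j<q with m≤n⇒∃[o]m+o≡n j<q
... | k , refl = λ S dom Sj →
  let open Pieces S dom in
  total (head ⊕ blocks j 3 ⊕ member (3 + j * 4) Sj ⊕ blocks k (3 + j * 4 + 1)
              ⊕ tail (3 + j * 4 + 1 + k * 4) (length≡ j k))
        (length≡ j k) (size≡ j k)
  where
  length≡ : ∀ j k → 3 + j * 4 + 1 + k * 4 + 3 ≡ 3 + suc (j + k) * 4
  length≡ = solve-∀
  size≡ : ∀ j k → 2 + j * 2 + 1 + k * 2 + 2 ≡ 2 + suc (j + k) * 2 + 1
  size≡ = solve-∀

half : ∀ {m} k → m ≡ k * 2 → m / 2 ≡ k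
half k refl = m*n/n≡m k 2

half-4q : ∀ q → q * 4 / 2 ≡ q * 2
half-4q q = half (q * 2) (sym (*-assoc q 2 2))

half-4q+2 : ∀ q → (2 + q * 4) / 2 ≡ 1 + q * 2
half-4q+2 q = half (1 + q * 2) (double q)
  where
  double : ∀ q → 2 + q * 4 ≡ (1 + q * 2) * 2
  double = solve-∀

half-4q+1+1 : ∀ q → (1 + q * 4 + 1) / 2 ≡ 1 + q * 2
half-4q+1+1 q = half (1 + q * 2) (double q)
  where
  double : ∀ q → 1 + q * 4 + 1 ≡ (1 + q * 2) * 2
  double = solve-∀

half-4q+3+1 : ∀ q → (3 + q * 4 + 1) / 2 ≡ 2 + q * 2
half-4q+3+1 q = half (2 + q * 2) (double q)
  where
  double : ∀ q → 3 + q * 4 + 1 ≡ (2 + q * 2) * 2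
  double = solve-∀

pathDtd-4q-4j : ∀ q j → pathDtd (q * 4) (suc (j * 4)) ≡ q * 2 + 1
pathDtd-4q-4j q j rewrite m*n%n≡0 q 4 ⦃ _ ⦄ | [m+kn]%n≡m%n 1 j 4 ⦃ _ ⦄ = cong (_+ 1) (half-4q q)

pathDtd-4q-4j+1 : ∀ q j → pathDtd (q * 4) (suc (1 + j * 4)) ≡ q * 2
pathDtd-4q-4j+1 q j rewrite m*n%n≡0 q 4 ⦃ _ ⦄ | [m+kn]%n≡m%n 2 j 4 ⦃ _ ⦄ = half-4q q

pathDtd-4q-4j+2 : ∀ q j → pathDtd (q * 4) (suc (2 + j * 4)) ≡ q * 2
pathDtd-4q-4j+2 q j rewrite m*n%n≡0 q 4 ⦃ _ ⦄ | [m+kn]%n≡m%n 3 j 4 ⦃ _ ⦄ = half-4q q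

pathDtd-4q-4j+3 : ∀ q j → pathDtd (q * 4) (suc (3 + j * 4)) ≡ q * 2 + 1
pathDtd-4q-4j+3 q j rewrite m*n%n≡0 q 4 ⦃ _ ⦄ | [m+kn]%n≡m%n 4 j 4 ⦃ _ ⦄ = cong (_+ 1) (half-4q q)

pathDtd-4q+1-4j : ∀ q j → pathDtd (1 + q * 4) (suc (j * 4)) ≡ 1 + q * 2 + 1
pathDtd-4q+1-4j q j rewrite [m+kn]%n≡m%n 1 q 4 ⦃ _ ⦄ | [m+kn]%n≡m%n 1 j 4 ⦃ _ ⦄ = cong (_+ 1) (half-4q+1+1 q)

pathDtd-4q+1-4j+1 : ∀ q j → pathDtd (1 + q * 4) (suc (1 + j * 4)) ≡ 1 + q * 2
pathDtd-4q+1-4j+1 q j rewrite [m+kn]%n≡m%n 1 q 4 ⦃ _ ⦄ | [m+kn]%n≡m%n 2 j 4 ⦃ _ ⦄ = half-4q+1+1 q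

pathDtd-4q+1-4j+2 : ∀ q j → pathDtd (1 + q * 4) (suc (2 + j * 4)) ≡ 1 + q * 2
pathDtd-4q+1-4j+2 q j rewrite [m+kn]%n≡m%n 1 q 4 ⦃ _ ⦄ | [m+kn]%n≡m%n 3 j 4 ⦃ _ ⦄ = half-4q+1+1 q

pathDtd-4q+1-4j+3 : ∀ q j → pathDtd (1 + q * 4) (suc (3 + j * 4)) ≡ 1 + q * 2
pathDtd-4q+1-4j+3 q j rewrite [m+kn]%n≡m%n 1 q 4 ⦃ _ ⦄ | [m+kn]%n≡m%n 4 j 4 ⦃ _ ⦄ = half-4q+1+1 q

pathDtd-4q+2 : ∀ q i → pathDtd (2 + q * 4) i ≡ 1 + q * 2 + 1
pathDtd-4q+2 q i rewrite [m+kn]%n≡m%n 2 q 4 ⦃ _ ⦄ = cong (_+ 1) (half-4q+2 q)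

pathDtd-4q+3-4j : ∀ q j → pathDtd (3 + q * 4) (suc (j * 4)) ≡ 2 + q * 2
pathDtd-4q+3-4j q j rewrite [m+kn]%n≡m%n 3 q 4 ⦃ _ ⦄ | [m+kn]%n≡m%n 1 j 4 ⦃ _ ⦄ = half-4q+3+1 q

pathDtd-4q+3-4j+1 : ∀ q j → pathDtd (3 + q * 4) (suc (1 + j * 4)) ≡ 2 + q * 2
pathDtd-4q+3-4j+1 q j rewrite [m+kn]%n≡m%n 3 q 4 ⦃ _ ⦄ | [m+kn]%n≡m%n 2 j 4 ⦃ _ ⦄ = half-4q+3+1 q

pathDtd-4q+3-4j+2 : ∀ q j → pathDtd (3 + q * 4) (suc (2 + j * 4)) ≡ 2 + q * 2
pathDtd-4q+3-4j+2 q j rewrite [m+kn]%n≡m%n 3 q 4 ⦃ _ ⦄ | [m+kn]%n≡m%n 3 j 4 ⦃ _ ⦄ = half-4q+3+1 q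

pathDtd-4q+3-4j+3 : ∀ q j → pathDtd (3 + q * 4) (suc (3 + j * 4)) ≡ 2 + q * 2 + 1
pathDtd-4q+3-4j+3 q j rewrite [m+kn]%n≡m%n 3 q 4 ⦃ _ ⦄ | [m+kn]%n≡m%n 4 j 4 ⦃ _ ⦄ = cong (_+ 1) (half-4q+3+1 q)

quotient-< : ∀ r t {q j} → r ≤ t → t + j * 4 < r + q * 4 → j < q
quotient-< r t {q} {j} r≤t i<n =
  *-cancelʳ-< 4 j q (+-cancelˡ-< t (j * 4) (q * 4) (<-≤-trans i<n (+-monoˡ-≤ (q * 4) r≤t)))

quotient-≤ : ∀ r t {q j} → r ≤ 4 → t + j * 4 < r + q * 4 → j ≤ q
quotient-≤ r t {q} {j} r≤4 i<n =
  ≤-pred (*-cancelʳ-< 4 j (suc q) (≤-<-trans (m≤n+m (j * 4) t) (<-≤-trans i<n (+-monoˡ-≤ (q * 4) r≤4))))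

bounds : ∀ {n i k k′} → k ≡ k′ → UpperBound n i k′ → LowerBound n i k′ → Bounds n i k
bounds refl upper lower = upper , lower

bounds-4q : ∀ q i → 2 ≤ q → i < q * 4 → Bounds (q * 4) i (pathDtd (q * 4) (suc i))
bounds-4q q i 2≤q i<n with i divMod 4
... | result j 0F refl = bounds (pathDtd-4q-4j q j) (upper-4q-4j q j 2≤q j<q) (lower-4q-4j q j j<q)
  where
  j<q : j < q
  j<q = quotient-< 0 0 z≤n i<n
... | result j 1F refl = bounds (pathDtd-4q-4j+1 q j)
  (upper-4q-4j+t q 1 j (λ _ → refl) (quotient-< 0 1 z≤n i<n)) (lower-4q q _)
... | result j 2F refl = bounds (pathDtd-4q-4j+2 q j)
  (upper-4q-4j+t q 2 j (λ _ → refl) (quotient-< 0 2 z≤n i<n)) (lower-4q q _)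
... | result j 3F refl = bounds (pathDtd-4q-4j+3 q j) (upper-4q-4j+3 q j 2≤q j<q) (lower-4q-4j+3 q j j<q)
  where
  j<q : j < q
  j<q = quotient-< 0 3 z≤n i<n

bounds-4q+1 : ∀ q i → 1 ≤ q → i < 1 + q * 4 → Bounds (1 + q * 4) i (pathDtd (1 + q * 4) (suc i))
bounds-4q+1 q i 1≤q i<n with i divMod 4
... | result j 0F refl = bounds (pathDtd-4q+1-4j q j) (upper-4q+1-4j q j 1≤q j≤q) (lower-4q+1-4j q j 1≤q j≤q)
  where
  j≤q : j ≤ q
  j≤q = quotient-≤ 1 0 (s≤s z≤n) i<n
... | result j 1F refl = bounds (pathDtd-4q+1-4j+1 q j)
  (upper-4q+1-4j+t q 1 j (λ _ → refl) refl (quotient-< 1 1 ≤-refl i<n)) (lower-4q+1 q _ 1≤q)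
... | result j 2F refl = bounds (pathDtd-4q+1-4j+2 q j)
  (upper-4q+1-4j+t q 2 j (λ _ → refl) refl (quotient-< 1 2 (s≤s z≤n) i<n)) (lower-4q+1 q _ 1≤q)
... | result j 3F refl = bounds (pathDtd-4q+1-4j+3 q j)
  (upper-4q+1-4j+3 q j (quotient-< 1 3 (s≤s z≤n) i<n)) (lower-4q+1 q _ 1≤q)

bounds-4q+2 : ∀ q i → i < 2 + q * 4 → Bounds (2 + q * 4) i (pathDtd (2 + q * 4) (suc i))
bounds-4q+2 q i i<n with i divMod 4
... | result j 0F refl = bounds (pathDtd-4q+2 q (suc (j * 4)))
  (upper-4q+2-4j+t q 0 j (λ _ → refl) refl (quotient-≤ 2 0 (s≤s (s≤s z≤n)) i<n)) (lower-4q+2 q _)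
... | result j 1F refl = bounds (pathDtd-4q+2 q (suc (1 + j * 4)))
  (upper-4q+2-4j+t q 1 j (λ _ → refl) refl (quotient-≤ 2 1 (s≤s (s≤s z≤n)) i<n)) (lower-4q+2 q _)
... | result j 2F refl = bounds (pathDtd-4q+2 q (suc (2 + j * 4)))
  (upper-4q+2-4j+t′ q 2 j (λ _ → refl) (λ _ → refl) (quotient-< 2 2 ≤-refl i<n)) (lower-4q+2 q _)
... | result j 3F refl = bounds (pathDtd-4q+2 q (suc (3 + j * 4)))
  (upper-4q+2-4j+t′ q 3 j (λ _ → refl) (λ _ → refl) (quotient-< 2 3 (s≤s (s≤s z≤n)) i<n)) (lower-4q+2 q _)

bounds-4q+3 : ∀ q i → q ≢ 1 → i < 3 + q * 4 → Bounds (3 + q * 4) i (pathDtd (3 + q * 4) (suc i))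
bounds-4q+3 q i q≢1 i<n with i divMod 4
... | result j 0F refl = bounds (pathDtd-4q+3-4j q j)
  (upper-4q+3-4j+t q 0 j (λ _ → refl) refl (quotient-≤ 3 0 (s≤s (s≤s (s≤s z≤n))) i<n)) (lower-4q+3 q _)
... | result j 1F refl = bounds (pathDtd-4q+3-4j+1 q j)
  (upper-4q+3-4j+t q 1 j (λ _ → refl) refl (quotient-≤ 3 1 (s≤s (s≤s (s≤s z≤n))) i<n)) (lower-4q+3 q _)
... | result j 2F refl = bounds (pathDtd-4q+3-4j+2 q j)
  (upper-4q+3-4j+t′ q 2 j (λ _ → refl) refl (quotient-≤ 3 2 (s≤s (s≤s (s≤s z≤n))) i<n)) (lower-4q+3 q _)
... | result j 3F refl = bounds (pathDtd-4q+3-4j+3 q j) (upper-4q+3-4j+3 q j q≢1 j<q) (lower-4q+3-4j+3 q j j<q)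
  where
  j<q : j < q
  j<q = quotient-< 3 3 ≤-refl i<n

path-bounds : ∀ n i → i < n → 2 ≤ n → n ≢ 4 → n ≢ 7 → Bounds n i (pathDtd n (suc i))
path-bounds n i i<n 2≤n n≢4 n≢7 with n divMod 4
... | result 0             0F refl with () ← 2≤n
... | result 1             0F refl = ⊥-elim (n≢4 refl)
... | result (suc (suc q)) 0F refl = bounds-4q (suc (suc q)) i (s≤s (s≤s z≤n)) i<n
... | result 0             1F refl with s≤s () ← 2≤n
... | result (suc q)       1F refl = bounds-4q+1 (suc q) i (s≤s z≤n) i<n
... | result q             2F refl = bounds-4q+2 q i i<n
... | result q             3F refl = bounds-4q+3 q i (λ { refl → n≢7 refl }) i<n

theorem4 : (n : ℕ) → 2 ≤ n → n ≢ 4 → n ≢ 7 → (a : Fin n) →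
    TDDegreeIs (PathAdj n) a (pathDtd n (suc (toℕ a)))
theorem4 n 2≤n n≢4 n≢7 a = degree-from-bounds a (path-bounds n (toℕ a) (toℕ<n a) 2≤n n≢4 n≢7)
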